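{- Let $c_n$ be the number of taxi walks of length $n$. Then $c_n=O\big(((1+\sqrt5)/2)^n\big)$.
   Context: The Manhattan lattice $\vec{\mathbb{Z}}^2$ is the orientation of $\mathbb{Z}^2$ in which an edge parallel to the $x$-axis is oriented in the positive $x$-direction if its $y$-coordinate is even and in the negative direction otherwise, and an edge parallel to the $y$-axis is oriented in the positive $y$-direction if its $x$-coordinate is even and in the negative direction otherwise. A taxi walk of length $n$ is an oriented walk of $n$ steps in $\vec{\mathbb{Z}}^2$ that begins at the origin, never revisits a vertex, and never takes two left turns or two right turns in a row. -}

module Defs where

open import Data.Bool using (Bool; true; false; _∧_; _∨_; not; if_then_else_)
open import Data.Nat as ℕ using (ℕ; zero; suc; _%_; _≡ᵇ_)
open import Data.Integer as ℤ using (ℤ; +_; ∣_∣)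
open import Data.Product using (_×_; _,_; proj₁; proj₂; ∃-syntax)
open import Data.Sum using (_⊎_)
open import Data.List using (List; []; _∷_; length; map; concatMap; filterᵇ)
open import Data.Bool.ListAction using (any)
open import Relation.Nullary.Decidable using (⌊_⌋)

Vertex : Set
Vertex = ℤ × ℤ

origin : Vertex
origin = (+ 0 , + 0)

data Dir : Set where
  E N W S : Dir

allDirs : List Dir
allDirs = E ∷ N ∷ W ∷ S ∷ []

move : Dir → Vertex → Vertex
move E (x , y) = (x ℤ.+ + 1 , y)
move W (x , y) = (x ℤ.- + 1 , y)
move N (x , y) = (x , y ℤ.+ + 1)
move S (x , y) = (x , y ℤ.- + 1)

evenᵇ : ℤ → Bool
evenᵇ z = (∣ z ∣ % 2) ≡ᵇ 0

-- Orientation of the Manhattan lattice: may we step in direction d from v?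
-- horizontal edges: +x if y even, -x if y odd;
-- vertical edges:   +y if x even, -y if x odd.
allowed : Vertex → Dir → Bool
allowed (x , y) E = evenᵇ y
allowed (x , y) W = not (evenᵇ y)
allowed (x , y) N = evenᵇ x
allowed (x , y) S = not (evenᵇ x)

oriented : Vertex → List Dir → Bool
oriented v []       = true
oriented v (d ∷ ds) = allowed v d ∧ oriented (move d v) ds

vertices : Vertex → List Dir → List Vertex
vertices v []       = v ∷ []
vertices v (d ∷ ds) = v ∷ vertices (move d v) ds

eqV : Vertex → Vertex → Bool
eqV (a , b) (c , d) = ⌊ a ℤ.≟ c ⌋ ∧ ⌊ b ℤ.≟ d ⌋

distinct : List Vertex → Bool
distinct []       = true
distinct (v ∷ vs) = not (any (eqV v) vs) ∧ distinct vs

leftTurn : Dir → Dir → Bool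
leftTurn E N = true
leftTurn N W = true
leftTurn W S = true
leftTurn S E = true
leftTurn _ _ = false

rightTurn : Dir → Dir → Bool
rightTurn d1 d2 = leftTurn d2 d1

noDoubleTurn : List Dir → Bool
noDoubleTurn (d1 ∷ d2 ∷ d3 ∷ ds) =
  not ((leftTurn d1 d2 ∧ leftTurn d2 d3) ∨ (rightTurn d1 d2 ∧ rightTurn d2 d3))
  ∧ noDoubleTurn (d2 ∷ d3 ∷ ds)
noDoubleTurn _ = true

isTaxi : List Dir → Bool
isTaxi ds = oriented origin ds ∧ distinct (vertices origin ds) ∧ noDoubleTurn ds

words : ℕ → List (List Dir)
words zero    = [] ∷ []
words (suc n) = concatMap (λ w → map (_∷ w) allDirs) (words n)

c : ℕ → ℕ
c n = length (filterᵇ isTaxi (words n))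

-- Fibonacci and Lucas numbers: φ^n = (L n + F n * √5) / 2, φ = (1+√5)/2
fib : ℕ → ℕ
fib zero = 0
fib (suc zero) = 1
fib (suc (suc n)) = fib (suc n) ℕ.+ fib n

lucas : ℕ → ℕ
lucas zero = 2
lucas (suc zero) = 1
lucas (suc (suc n)) = lucas (suc n) ℕ.+ lucas n

-- a ≤ C * φ^n, i.e. 2a ≤ C*L n + C*F n*√5, written exactly with integers:
-- with d = 2a - C*L n, this holds iff d ≤ 0 or d² ≤ 5 * (C*F n)².
LeCPhiPow : ℕ → ℕ → ℕ → Set
LeCPhiPow C n a =
  let d = (+ (2 ℕ.* a)) ℤ.- (+ (C ℕ.* lucas n))
      f = + (C ℕ.* fib n)
  in (d ℤ.≤ + 0) ⊎ (d ℤ.* d ℤ.≤ + 5 ℤ.* (f ℤ.* f))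

{-# OPTIONS --safe #-}
module Submission where

-- Only the parities of the coordinates matter for the orientation, and at every vertex
-- exactly one horizontal and one vertical step are allowed; going straight is always one of
-- them. Two consecutive turns are impossible in a taxi walk: a turn flips the parity that
-- fixes the orientation of the lines parallel to the previous step, so a second turn would
-- go back against that step, i.e. it would turn in the same sense as the first one.
-- Ignoring self-avoidance, a taxi walk is therefore a first step followed by a
-- straight/turn word without two consecutive turns, of which there are Fibonacci many:
-- c n ≤ 4 F(n+1) ≤ 4 L(n), and L(n) ≤ 2 φⁿ.

open import Defs
open import Data.Nat using (ℕ)
open import Data.Product using (∃-syntax)

open import Algebra.Bundles using (CommutativeMonoid)
open import Data.Bool using (Bool; true; false; _∧_; _∨_; not; if_then_else_; T)
import Data.Bool.Properties as Boolₚ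
open import Algebra.Properties.CommutativeSemigroup
  (CommutativeMonoid.commutativeSemigroup Boolₚ.∧-commutativeMonoid) using (interchange)
open import Data.Bool.ListAction using (all)
open import Data.Empty using (⊥-elim)
import Data.Integer as ℤ
open import Data.Integer.Properties using (i≤j⇒i-j≤0)
open import Data.List using (List; []; _∷_; _++_; length; map; concatMap; filterᵇ)
open import Data.List.Properties using (length-++; filter-++; length-filter)
open import Data.List.Membership.Propositional using (_∈_)
open import Data.List.Relation.Unary.Any using (here; there)
import Data.List.Relation.Unary.All as All
open import Data.List.Relation.Unary.All.Properties using (all⁺)
open import Data.Nat using (zero; suc; _+_; _*_; _≤_; _≤ᵇ_; z≤n; s≤s)
open import Data.Nat.ListAction using (sum)
open import Data.Nat.Properties
open import Data.Nat.Tactic.RingSolver using (solve-∀)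
open import Data.Product using (_×_; _,_; proj₁; proj₂)
open import Data.Sum using (inj₁)
open import Function using (_∘_)
open import Function.Bundles using (module Equivalence)
open import Relation.Binary.PropositionalEquality
open import Relation.Nullary.Decidable using (T?)

Parity : Set
Parity = Bool × Bool

parity : Vertex → Parity
parity (x , y) = evenᵇ x , evenᵇ y

stepᵖ : Dir → Parity → Parity
stepᵖ E (a , b) = not a , b
stepᵖ W (a , b) = not a , b
stepᵖ N (a , b) = a , not b
stepᵖ S (a , b) = a , not b

allowedᵖ : Parity → Dir → Bool
allowedᵖ (a , b) E = b
allowedᵖ (a , b) W = not b
allowedᵖ (a , b) N = a
allowedᵖ (a , b) S = not a

orientedᵖ : Parity → List Dir → Bool
orientedᵖ p []       = true
orientedᵖ p (d ∷ ds) = allowedᵖ p d ∧ orientedᵖ (stepᵖ d p) ds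

evenᵇ-suc : ∀ n → evenᵇ (ℤ.+ suc n) ≡ not (evenᵇ (ℤ.+ n))
evenᵇ-suc zero          = refl
evenᵇ-suc (suc zero)    = refl
evenᵇ-suc (suc (suc n)) = evenᵇ-suc n

evenᵇ-pred : ∀ n → evenᵇ (ℤ.+ n) ≡ not (evenᵇ (ℤ.+ suc n))
evenᵇ-pred zero          = refl
evenᵇ-pred (suc zero)    = refl
evenᵇ-pred (suc (suc n)) = evenᵇ-pred n

evenᵇ-+1 : ∀ x → evenᵇ (x ℤ.+ ℤ.+ 1) ≡ not (evenᵇ x)
evenᵇ-+1 (ℤ.+ n) rewrite +-comm n 1 = evenᵇ-suc n
evenᵇ-+1 ℤ.-[1+ zero ]  = refl
evenᵇ-+1 ℤ.-[1+ suc n ] = evenᵇ-pred (suc n)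

evenᵇ-−1 : ∀ x → evenᵇ (x ℤ.- ℤ.+ 1) ≡ not (evenᵇ x)
evenᵇ-−1 (ℤ.+ zero)  = refl
evenᵇ-−1 (ℤ.+ suc n) = evenᵇ-pred n
evenᵇ-−1 ℤ.-[1+ n ] rewrite +-identityʳ n = evenᵇ-suc (suc n)

parity-move : ∀ d v → parity (move d v) ≡ stepᵖ d (parity v)
parity-move E (x , y) = cong (_, evenᵇ y) (evenᵇ-+1 x)
parity-move W (x , y) = cong (_, evenᵇ y) (evenᵇ-−1 x)
parity-move N (x , y) = cong (evenᵇ x ,_) (evenᵇ-+1 y)
parity-move S (x , y) = cong (evenᵇ x ,_) (evenᵇ-−1 y)

allowed-parity : ∀ v d → allowed v d ≡ allowedᵖ (parity v) d
allowed-parity v E = refl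
allowed-parity v W = refl
allowed-parity v N = refl
allowed-parity v S = refl

oriented-parity : ∀ v ds → oriented v ds ≡ orientedᵖ (parity v) ds
oriented-parity v []       = refl
oriented-parity v (d ∷ ds) =
  cong₂ _∧_ (allowed-parity v d)
            (trans (oriented-parity (move d v) ds) (cong (λ p → orientedᵖ p ds) (parity-move d v)))

stepᵖ-involutive : ∀ d p → stepᵖ d (stepᵖ d p) ≡ p
stepᵖ-involutive E (a , b) = cong (_, b) (Boolₚ.not-involutive a)
stepᵖ-involutive W (a , b) = cong (_, b) (Boolₚ.not-involutive a)
stepᵖ-involutive N (a , b) = cong (a ,_) (Boolₚ.not-involutive b)
stepᵖ-involutive S (a , b) = cong (a ,_) (Boolₚ.not-involutive b)

straight-allowedᵖ : ∀ p d → T (allowedᵖ p d) → T (allowedᵖ (stepᵖ d p) d)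
straight-allowedᵖ (a , b) E t = t
straight-allowedᵖ (a , b) W t = t
straight-allowedᵖ (a , b) N t = t
straight-allowedᵖ (a , b) S t = t

𝟙 : Bool → ℕ
𝟙 b = if b then 1 else 0

count : (List Dir → Bool) → List (List Dir) → ℕ
count P ws = length (filterᵇ P ws)

count-∷ : ∀ P w ws → count P (w ∷ ws) ≡ 𝟙 (P w) + count P ws
count-∷ P w ws with P w
... | true  = refl
... | false = refl

count-++ : ∀ P ws vs → count P (ws ++ vs) ≡ count P ws + count P vs
count-++ P ws vs = trans (cong length (filter-++ _ ws vs)) (length-++ (filterᵇ P ws))

count-map : ∀ {A : Set} P (f : A → List Dir) xs → count P (map f xs) ≡ sum (map (λ x → 𝟙 (P (f x))) xs)
count-map P f []       = refl
count-map P f (x ∷ xs) = trans (count-∷ P (f x) (map f xs)) (cong (𝟙 (P (f x)) +_) (count-map P f xs))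

count-mono : ∀ {P Q} → (∀ w → T (P w) → T (Q w)) → ∀ ws → count P ws ≤ count Q ws
count-mono {P} {Q} P⇒Q []       = z≤n
count-mono {P} {Q} P⇒Q (w ∷ ws) with P w in Pw | Q w in Qw
... | true  | true  = s≤s (count-mono P⇒Q ws)
... | true  | false = ⊥-elim (subst T Qw (P⇒Q w (subst T (sym Pw) _)))
... | false | true  = m≤n⇒m≤1+n (count-mono P⇒Q ws)
... | false | false = count-mono P⇒Q ws

count-if : ∀ b P ws → count (λ w → b ∧ P w) ws ≡ (if b then count P ws else 0)
count-if true  P ws = refl
count-if false P []       = refl
count-if false P (w ∷ ws) = count-if false P ws

count-cong : ∀ {P Q} → (∀ w → P w ≡ Q w) → ∀ ws → count P ws ≡ count Q ws
count-cong P≗Q ws =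
  ≤-antisym (count-mono (λ w → subst T (P≗Q w)) ws) (count-mono (λ w → subst T (sym (P≗Q w))) ws)

count≤length : ∀ P ws → count P ws ≤ length ws
count≤length P ws = length-filter (T? ∘ P) ws

sumDir : (Dir → ℕ) → ℕ
sumDir f = sum (map f allDirs)

sumDir-cong : ∀ {f g} → (∀ d → f d ≡ g d) → sumDir f ≡ sumDir g
sumDir-cong f≗g = cong₂ _+_ (f≗g E) (cong₂ _+_ (f≗g N) (cong₂ _+_ (f≗g W) (cong (_+ 0) (f≗g S))))

sumDir-mono : ∀ {f g} → (∀ d → f d ≤ g d) → sumDir f ≤ sumDir g
sumDir-mono f≤g = +-mono-≤ (f≤g E) (+-mono-≤ (f≤g N) (+-mono-≤ (f≤g W) (+-monoˡ-≤ 0 (f≤g S))))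

sumDir-linear : ∀ f g X Y → sumDir (λ d → f d * X + g d * Y) ≡ sumDir f * X + sumDir g * Y
sumDir-linear f g X Y = linear (f E) (f N) (f W) (f S) (g E) (g N) (g W) (g S) X Y
  where
  linear : ∀ a b c d a′ b′ c′ d′ X Y →
    (a * X + a′ * Y) + ((b * X + b′ * Y) + ((c * X + c′ * Y) + ((d * X + d′ * Y) + 0)))
      ≡ (a + (b + (c + (d + 0)))) * X + (a′ + (b′ + (c′ + (d′ + 0)))) * Y
  linear = solve-∀

sumDir-+ : ∀ f g → sumDir (λ d → f d + g d) ≡ sumDir f + sumDir g
sumDir-+ f g = additive (f E) (f N) (f W) (f S) (g E) (g N) (g W) (g S)
  where
  additive : ∀ a b c d a′ b′ c′ d′ →
    (a + a′) + ((b + b′) + ((c + c′) + ((d + d′) + 0)))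
      ≡ (a + (b + (c + (d + 0)))) + (a′ + (b′ + (c′ + (d′ + 0))))
  additive = solve-∀

count-words-suc : ∀ P n → count P (words (suc n)) ≡ sumDir (λ d → count (λ w → P (d ∷ w)) (words n))
count-words-suc P n = go (words n)
  where
  go : ∀ ws → count P (concatMap (λ w → map (_∷ w) allDirs) ws) ≡ sumDir (λ d → count (λ w → P (d ∷ w)) ws)
  go []       = refl
  go (w ∷ ws) = begin
    count P (map (_∷ w) allDirs ++ concatMap (λ w → map (_∷ w) allDirs) ws)
      ≡⟨ count-++ P (map (_∷ w) allDirs) _ ⟩
    count P (map (_∷ w) allDirs) + count P (concatMap (λ w → map (_∷ w) allDirs) ws)
      ≡⟨ cong₂ _+_ (count-map P (_∷ w) allDirs) (go ws) ⟩
    sumDir (λ d → 𝟙 (P (d ∷ w))) + sumDir (λ d → count (λ w → P (d ∷ w)) ws)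
      ≡⟨ sym (sumDir-+ (λ d → 𝟙 (P (d ∷ w))) (λ d → count (λ w → P (d ∷ w)) ws)) ⟩
    sumDir (λ d → 𝟙 (P (d ∷ w)) + count (λ w → P (d ∷ w)) ws)
      ≡⟨ sumDir-cong (λ d → sym (count-∷ (λ w → P (d ∷ w)) w ws)) ⟩
    sumDir (λ d → count (λ w → P (d ∷ w)) (w ∷ ws)) ∎
    where open ≡-Reasoning

twoSameTurns : Dir → Dir → Dir → Bool
twoSameTurns a b d = (leftTurn a b ∧ leftTurn b d) ∨ (rightTurn a b ∧ rightTurn b d)

turn : Dir → Dir → Bool
turn a b = leftTurn a b ∨ rightTurn a b

noDoubleTurn-repeat : ∀ d w → noDoubleTurn (d ∷ d ∷ w) ≡ noDoubleTurn (d ∷ w)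
noDoubleTurn-repeat d []      = refl
noDoubleTurn-repeat E (_ ∷ _) = refl
noDoubleTurn-repeat N (_ ∷ _) = refl
noDoubleTurn-repeat W (_ ∷ _) = refl
noDoubleTurn-repeat S (_ ∷ _) = refl

turn-refl : ∀ d → turn d d ≡ false
turn-refl E = refl
turn-refl N = refl
turn-refl W = refl
turn-refl S = refl

-- w may extend a walk whose last two steps were a, b and which has reached parity p
continues : Parity → Dir → Dir → List Dir → Bool
continues p a b w = orientedᵖ p w ∧ noDoubleTurn (a ∷ b ∷ w)

canStep : Parity → Dir → Dir → Dir → Bool
canStep p a b d = allowedᵖ p d ∧ not (twoSameTurns a b d)

continues-∷ : ∀ p a b d w → continues p a b (d ∷ w) ≡ canStep p a b d ∧ continues (stepᵖ d p) b d w
continues-∷ p a b d w = interchange (allowedᵖ p d) _ _ _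

-- a and b are the last two steps of an oriented walk that has reached parity p
legal : Parity → Dir → Dir → Bool
legal p a b = allowedᵖ (stepᵖ b p) b ∧ allowedᵖ (stepᵖ a (stepᵖ b p)) a

legal-step : ∀ p a b d → T (legal p a b) → T (allowedᵖ p d) → T (legal (stepᵖ d p) b d)
legal-step p a b d lab pd rewrite stepᵖ-involutive d p =
  Equivalence.from Boolₚ.T-∧ (pd , proj₁ (Equivalence.to Boolₚ.T-∧ lab))

legal-start : ∀ p d → T (allowedᵖ p d) → T (legal (stepᵖ d p) d d)
legal-start p d pd rewrite stepᵖ-involutive d p =
  Equivalence.from Boolₚ.T-∧ (pd , straight-allowedᵖ p d pd)

choices : Parity → Dir → Dir → ℕ
choices p a b = sumDir (λ d → 𝟙 (canStep p a b d))

straightChoices : Parity → Dir → Dir → ℕ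
straightChoices p a b = sumDir (λ d → 𝟙 (canStep p a b d ∧ not (turn b d)))

allParities : List Parity
allParities = (true , true) ∷ (true , false) ∷ (false , true) ∷ (false , false) ∷ []

∈-allParities : ∀ p → p ∈ allParities
∈-allParities (true  , true)  = here refl
∈-allParities (true  , false) = there (here refl)
∈-allParities (false , true)  = there (there (here refl))
∈-allParities (false , false) = there (there (there (here refl)))

∈-allDirs : ∀ d → d ∈ allDirs
∈-allDirs E = here refl
∈-allDirs N = there (here refl)
∈-allDirs W = there (there (here refl))
∈-allDirs S = there (there (there (here refl)))

all-∈ : ∀ {A : Set} (f : A → Bool) xs {x} → T (all f xs) → x ∈ xs → T (f x)
all-∈ f xs t = All.lookup (all⁺ f xs t)

every-state : (P : Parity → Dir → Dir → Bool) →
  T (all (λ p → all (λ a → all (P p a) allDirs) allDirs) allParities) → ∀ p a b → T (P p a b)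
every-state P t p a b =
  all-∈ (P p a) allDirs (all-∈ (λ a → all (P p a) allDirs) allDirs
    (all-∈ (λ p → all (λ a → all (P p a) allDirs) allDirs) allParities t (∈-allParities p))
    (∈-allDirs a)) (∈-allDirs b)

T-if : ∀ {b r} → T (if b then r else true) → T b → T r
T-if {true} t _ = t

-- After a turn the walk must go straight: the other allowed step would turn the same way again.
choices-≤ : ∀ p a b → T (legal p a b) → choices p a b ≤ (if turn a b then 1 else 2)
choices-≤ p a b lab = ≤ᵇ⇒≤ _ _ (T-if (every-state check _ p a b) lab)
  where
  check : Parity → Dir → Dir → Bool
  check p a b = if legal p a b then choices p a b ≤ᵇ (if turn a b then 1 else 2) else true

straightChoices-≤ : ∀ p a b → straightChoices p a b ≤ 1
straightChoices-≤ p a b = ≤ᵇ⇒≤ _ _ (every-state (λ p a b → straightChoices p a b ≤ᵇ 1) _ p a b)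

bound : Bool → ℕ → ℕ
bound turned n = if turned then fib (suc n) else fib (suc (suc n))

bound-suc : ∀ t n → (if t then 1 else 2) * fib (suc n) + 1 * fib n ≡ bound t (suc n)
bound-suc true  n = identity (fib (suc n)) (fib n)
  where
  identity : ∀ X Y → 1 * X + 1 * Y ≡ X + Y
  identity = solve-∀
bound-suc false n = identity (fib (suc n)) (fib n)
  where
  identity : ∀ X Y → 2 * X + 1 * Y ≡ X + Y + X
  identity = solve-∀

bound-split : ∀ c t n → (if c then bound t n else 0) ≡ 𝟙 c * fib (suc n) + 𝟙 (c ∧ not t) * fib n
bound-split false t     n = refl
bound-split true  true  n = sym (trans (+-identityʳ (1 * fib (suc n))) (*-identityˡ (fib (suc n))))
bound-split true  false n = sym (cong₂ _+_ (*-identityˡ (fib (suc n))) (*-identityˡ (fib n)))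

continuations-≤ : ∀ n p a b → T (legal p a b) → count (continues p a b) (words n) ≤ bound (turn a b) n
continuations-≤ zero    p a b lab =
  ≤-trans (count≤length (continues p a b) ([] ∷ [])) (bound-pos (turn a b))
  where
  bound-pos : ∀ t → 1 ≤ bound t 0
  bound-pos true  = ≤-refl
  bound-pos false = ≤-refl
continuations-≤ (suc n) p a b lab = begin
  count (continues p a b) (words (suc n))
    ≡⟨ count-words-suc (continues p a b) n ⟩
  sumDir (λ d → count (λ w → continues p a b (d ∷ w)) (words n))
    ≡⟨ sumDir-cong (λ d → trans (count-cong (continues-∷ p a b d) (words n))
                                (count-if (canStep p a b d) (continues (stepᵖ d p) b d) (words n))) ⟩
  sumDir (λ d → if canStep p a b d then count (continues (stepᵖ d p) b d) (words n) else 0)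
    ≤⟨ sumDir-mono continuation ⟩
  sumDir (λ d → if canStep p a b d then bound (turn b d) n else 0)
    ≡⟨ trans (sumDir-cong (λ d → bound-split (canStep p a b d) (turn b d) n))
             (sumDir-linear (λ d → 𝟙 (canStep p a b d)) (λ d → 𝟙 (canStep p a b d ∧ not (turn b d)))
                            (fib (suc n)) (fib n)) ⟩
  choices p a b * fib (suc n) + straightChoices p a b * fib n
    ≤⟨ +-mono-≤ (*-monoˡ-≤ (fib (suc n)) (choices-≤ p a b lab))
                (*-monoˡ-≤ (fib n) (straightChoices-≤ p a b)) ⟩
  (if turn a b then 1 else 2) * fib (suc n) + 1 * fib n
    ≡⟨ bound-suc (turn a b) n ⟩
  bound (turn a b) (suc n) ∎
  where
  open ≤-Reasoning
  continuation : ∀ d → (if canStep p a b d then count (continues (stepᵖ d p) b d) (words n) else 0)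
                       ≤ (if canStep p a b d then bound (turn b d) n else 0)
  continuation d with canStep p a b d in step
  ... | false = z≤n
  ... | true  = continuations-≤ n (stepᵖ d p) b d
                  (legal-step p a b d lab (proj₁ (Equivalence.to Boolₚ.T-∧ (subst T (sym step) _))))

noDoubleTurnWalks-≤ : ∀ p n → count (λ w → orientedᵖ p w ∧ noDoubleTurn w) (words n) ≤ 4 * fib (suc n)
noDoubleTurnWalks-≤ p zero    =
  ≤-trans (count≤length (λ w → orientedᵖ p w ∧ noDoubleTurn w) ([] ∷ [])) (s≤s z≤n)
noDoubleTurnWalks-≤ p (suc n) = begin
  count (λ w → orientedᵖ p w ∧ noDoubleTurn w) (words (suc n))
    ≡⟨ count-words-suc (λ w → orientedᵖ p w ∧ noDoubleTurn w) n ⟩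
  sumDir (λ d → count (λ w → orientedᵖ p (d ∷ w) ∧ noDoubleTurn (d ∷ w)) (words n))
    ≡⟨ sumDir-cong (λ d → trans (count-cong (first-step d) (words n))
                                (count-if (allowedᵖ p d) (continues (stepᵖ d p) d d) (words n))) ⟩
  sumDir (λ d → if allowedᵖ p d then count (continues (stepᵖ d p) d d) (words n) else 0)
    ≤⟨ sumDir-mono first-step-≤ ⟩
  4 * fib (suc (suc n)) ∎
  where
  open ≤-Reasoning
  -- the walk is treated as having arrived along its first step, which adds no turn
  first-step : ∀ d w → (orientedᵖ p (d ∷ w) ∧ noDoubleTurn (d ∷ w))
                       ≡ (allowedᵖ p d ∧ continues (stepᵖ d p) d d w)
  first-step d w = trans (Boolₚ.∧-assoc (allowedᵖ p d) _ _)
                         (cong (λ t → allowedᵖ p d ∧ (orientedᵖ (stepᵖ d p) w ∧ t)) (sym (noDoubleTurn-repeat d w)))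
  first-step-≤ : ∀ d → (if allowedᵖ p d then count (continues (stepᵖ d p) d d) (words n) else 0)
                       ≤ fib (suc (suc n))
  first-step-≤ d with allowedᵖ p d in allowed
  ... | false = z≤n
  ... | true  = subst (λ t → count (continues (stepᵖ d p) d d) (words n) ≤ bound t n) (turn-refl d)
                  (continuations-≤ n (stepᵖ d p) d d (legal-start p d (subst T (sym allowed) _)))

c≤4*fib : ∀ n → c n ≤ 4 * fib (suc n)
c≤4*fib n = ≤-trans (count-mono taxi⇒ (words n)) (noDoubleTurnWalks-≤ (parity origin) n)
  where
  taxi⇒ : ∀ w → T (isTaxi w) → T (orientedᵖ (parity origin) w ∧ noDoubleTurn w)
  taxi⇒ w taxi with Equivalence.to Boolₚ.T-∧ taxi
  ... | isOriented , rest = Equivalence.from Boolₚ.T-∧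
          (subst T (oriented-parity origin w) isOriented , proj₂ (Equivalence.to Boolₚ.T-∧ rest))

fib[1+n]≤lucas : ∀ n → fib (suc n) ≤ lucas n
fib[1+n]≤lucas zero          = s≤s z≤n
fib[1+n]≤lucas (suc zero)    = s≤s z≤n
fib[1+n]≤lucas (suc (suc n)) = +-mono-≤ (fib[1+n]≤lucas (suc n)) (fib[1+n]≤lucas n)

LeCPhiPow-fromLucas : ∀ C n a → 2 * a ≤ C * lucas n → LeCPhiPow C n a
LeCPhiPow-fromLucas C n a 2a≤CL = inj₁ (i≤j⇒i-j≤0 (ℤ.+≤+ 2a≤CL))

lemma2p5 : ∃[ C ] (∀ (n : ℕ) → LeCPhiPow C n (c n))
lemma2p5 = 8 , λ n → LeCPhiPow-fromLucas 8 n (c n) (begin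
  2 * c n                  ≤⟨ *-monoʳ-≤ 2 (c≤4*fib n) ⟩
  2 * (4 * fib (suc n))    ≡⟨ sym (*-assoc 2 4 (fib (suc n))) ⟩
  8 * fib (suc n)          ≤⟨ *-monoʳ-≤ 8 (fib[1+n]≤lucas n) ⟩
  8 * lucas n              ∎)
  where open ≤-Reasoning
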